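{- Let $D_1,\dots,D_k$ be path degree sequences on a common set of $n$ vertices without common leaves. Then they have edge disjoint realizations, i.e. there exist pairwise edge-disjoint simple graphs $G_1,\dots,G_k$ on these $n$ vertices such that each $G_i$ has degree sequence $D_i$.
   Context: A path degree sequence is a degree sequence in which exactly two entries equal $1$ and all other entries equal $2$. $d_v^{(i)}$ denotes the entry of vertex $v$ in $D_i$. The sequences have no common leaves if for every vertex $v$ and index $i$, $d_v^{(i)}=1$ implies $d_v^{(j)}>1$ for all $j\ne i$. -}

module Defs where

open import Data.Nat using (ℕ; _+_; _>_)
open import Data.Bool using (Bool; true; false)
open import Data.Fin using (Fin)
open import Data.List using (List; map)
open import Data.Nat.ListAction using (sum)
open import Data.List.Base using (allFin)
open import Data.Product using (Σ; _×_; ∃-syntax)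
open import Relation.Binary.PropositionalEquality using (_≡_; _≢_)

record SimpleGraph (n : ℕ) : Set where
  field
    adj   : Fin n → Fin n → Bool
    sym   : ∀ u v → adj u v ≡ adj v u
    irrefl : ∀ v → adj v v ≡ false
open SimpleGraph public

𝟙 : Bool → ℕ
𝟙 true  = 1
𝟙 false = 0

degree : ∀ {n} → SimpleGraph n → Fin n → ℕ
degree {n} G v = sum (map (λ u → 𝟙 (adj G v u)) (allFin n))

DegSeq : ℕ → Set
DegSeq n = Fin n → ℕ

Realizes : ∀ {n} → SimpleGraph n → DegSeq n → Set
Realizes G D = ∀ v → degree G v ≡ D v

IsPathDegSeq : ∀ {n} → DegSeq n → Set
IsPathDegSeq {n} D =
  ∃[ a ] ∃[ b ] (a ≢ b × D a ≡ 1 × D b ≡ 1 ×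
     (∀ v → v ≢ a → v ≢ b → D v ≡ 2))

NoCommonLeaves : ∀ {k n} → (Fin k → DegSeq n) → Set
NoCommonLeaves {k} {n} D =
  ∀ (v : Fin n) (i j : Fin k) → i ≢ j → D i v ≡ 1 → D j v > 1

EdgeDisjoint : ∀ {k n} → (Fin k → SimpleGraph n) → Set
EdgeDisjoint {k} {n} G =
  ∀ (i j : Fin k) → i ≢ j → ∀ (u v : Fin n) →
    adj (G i) u v ≡ true → adj (G j) u v ≡ false

-- The k paths are carved out of a fixed decomposition of K_n. On the labels
-- 0 … n-1 let R_s be the reflection x ↦ s - x (mod n); for each j < ⌊n/2⌋ the
-- graph with edges {x , R_s x} for s ∈ {2j, 2j+1} has degree 2 everywhere
-- except at the two fixed points of R_{2j} and R_{2j+1}, which are j and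
-- j + ⌈n/2⌉; graphs for distinct j use disjoint sum classes, hence disjoint
-- edges. The leaves of the D_i are pairwise distinct, so 2k ≤ n and a
-- permutation of the vertices sends the leaves of D_i to i and i + ⌈n/2⌉.
module Submission where

open import Defs hiding (sym)
open import Algebra.Definitions using (Involutive)
open import Data.Bool using (Bool; true; false; not)
open import Data.Bool.Properties using (not-¬)
open import Data.Empty using (⊥-elim)
open import Data.Fin using (Fin; zero; suc; toℕ; fromℕ<; splitAt; join)
open import Data.Fin.Properties
  using (toℕ-injective; toℕ<n; toℕ-fromℕ<; splitAt-join; +↔⊎; injective⇒≤)
  renaming (_≟_ to _≟ᶠ_; suc-injective to sucᶠ-injective; 0≢1+n to zero≢sucᶠ)
open import Data.Fin.Permutation
  using (Permutation; _⟨$⟩ʳ_; _⟨$⟩ˡ_; inverseˡ; inverseʳ; transpose; _∘ₚ_; id)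
open import Data.List using (map; allFin; tabulate)
open import Data.List.Properties using (map-tabulate)
open import Data.Nat
open import Data.Nat.ListAction using (sum)
open import Data.Nat.Properties
open import Data.Nat.Tactic.RingSolver using (solve-∀)
open import Algebra.Properties.CommutativeSemigroup +-commutativeSemigroup using (interchange)
open import Data.Product using (Σ-syntax; ∃-syntax; _×_; _,_; proj₁; proj₂)
open import Data.Sum using (_⊎_; inj₁; inj₂; [_,_]′)
open import Function using (_∘_; case_of_; _⇔_; mk⇔; Injection)
open import Function.Definitions using (Injective)
open import Function.Properties.Inverse using (↔⇒↣)
open import Relation.Binary.PropositionalEquality
open import Relation.Nullary using (¬_; Dec; yes; no; does; ¬?; _×-dec_; _⊎-dec_)
open import Relation.Nullary.Decidable using (dec-true; dec-false; does-⇔)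

does-true⇒ : ∀ {A : Set} (a? : Dec A) → does a? ≡ true → A
does-true⇒ (yes a) _  = a
does-true⇒ (no _)  ()

count : ∀ {n} → (Fin n → Bool) → ℕ
count {zero}  f = 0
count {suc n} f = 𝟙 (f zero) + count (f ∘ suc)

sum-𝟙-allFin : ∀ {n} (f : Fin n → Bool) → sum (map (λ v → 𝟙 (f v)) (allFin n)) ≡ count f
sum-𝟙-allFin {zero}  f = refl
sum-𝟙-allFin {suc n} f = cong (𝟙 (f zero) +_) (begin
  sum (map g (tabulate suc))           ≡⟨ cong sum (map-tabulate suc g) ⟩
  sum (tabulate (g ∘ suc))             ≡⟨ cong sum (map-tabulate (λ v → v) (g ∘ suc)) ⟨
  sum (map (g ∘ suc) (allFin n))       ≡⟨ sum-𝟙-allFin (f ∘ suc) ⟩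
  count (f ∘ suc)                      ∎)
  where
  open ≡-Reasoning
  g = λ v → 𝟙 (f v)

count-cong : ∀ {n} {f g : Fin n → Bool} → (∀ v → f v ≡ g v) → count f ≡ count g
count-cong {zero}  f≗g = refl
count-cong {suc n} f≗g = cong₂ _+_ (cong 𝟙 (f≗g zero)) (count-cong (f≗g ∘ suc))

count-false : ∀ {n} → count {n} (λ _ → false) ≡ 0
count-false {zero}  = refl
count-false {suc n} = count-false {n}

count-≟ : ∀ {n} (p : Fin n) → count (λ v → does (v ≟ᶠ p)) ≡ 1
count-≟ {suc n} zero    =
  cong suc (trans (count-cong {n} (λ v → dec-false (suc v ≟ᶠ zero) λ ())) (count-false {n}))
count-≟ {suc n} (suc p) = count-≟ p

count-⊎ : ∀ {n} {P Q : Fin n → Set} (P? : ∀ v → Dec (P v)) (Q? : ∀ v → Dec (Q v)) →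
          (∀ v → P v → ¬ Q v) →
          count (λ v → does (P? v ⊎-dec Q? v)) ≡ count (does ∘ P?) + count (does ∘ Q?)
count-⊎ {zero}  P? Q? disjoint = refl
count-⊎ {suc n} P? Q? disjoint = begin
  𝟙 (does (P? zero ⊎-dec Q? zero)) + count (λ v → does (P? (suc v) ⊎-dec Q? (suc v)))
    ≡⟨ cong₂ _+_ (𝟙-does-⊎ (P? zero) (Q? zero) (disjoint zero))
                 (count-⊎ (P? ∘ suc) (Q? ∘ suc) (disjoint ∘ suc)) ⟩
  (𝟙 (does (P? zero)) + 𝟙 (does (Q? zero))) + (count (does ∘ P? ∘ suc) + count (does ∘ Q? ∘ suc))
    ≡⟨ interchange (𝟙 (does (P? zero))) (𝟙 (does (Q? zero)))
                   (count (does ∘ P? ∘ suc)) (count (does ∘ Q? ∘ suc)) ⟩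
  count (does ∘ P?) + count (does ∘ Q?) ∎
  where
  open ≡-Reasoning
  𝟙-does-⊎ : ∀ {A B : Set} (a? : Dec A) (b? : Dec B) → (A → ¬ B) →
             𝟙 (does (a? ⊎-dec b?)) ≡ 𝟙 (does a?) + 𝟙 (does b?)
  𝟙-does-⊎ (yes a) b? a⇒¬b rewrite dec-false b? (a⇒¬b a) = refl
  𝟙-does-⊎ (no _)  b? _     = refl

count-exactly-one : ∀ {n} {P : Fin n → Set} (P? : ∀ v → Dec (P v)) {p} →
                    (∀ v → P v ⇔ v ≡ p) → count (does ∘ P?) ≡ 1
count-exactly-one P? {p} P⇔ = trans (count-cong λ v → does-⇔ (P⇔ v) (P? v) (v ≟ᶠ p)) (count-≟ p)

count-exactly-two : ∀ {n} {P : Fin n → Set} (P? : ∀ v → Dec (P v)) {p q} → p ≢ q →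
                    (∀ v → P v ⇔ (v ≡ p ⊎ v ≡ q)) → count (does ∘ P?) ≡ 2
count-exactly-two P? {p} {q} p≢q P⇔ = begin
  count (does ∘ P?)
    ≡⟨ count-cong (λ v → does-⇔ (P⇔ v) (P? v) (v ≟ᶠ p ⊎-dec v ≟ᶠ q)) ⟩
  count (λ v → does (v ≟ᶠ p ⊎-dec v ≟ᶠ q))
    ≡⟨ count-⊎ (_≟ᶠ p) (_≟ᶠ q) (λ v v≡p v≡q → p≢q (trans (sym v≡p) v≡q)) ⟩
  count (λ v → does (v ≟ᶠ p)) + count (λ v → does (v ≟ᶠ q))
    ≡⟨ cong₂ _+_ (count-≟ p) (count-≟ q) ⟩
  2 ∎
  where open ≡-Reasoning

⟨$⟩ʳ-injective : ∀ {n} (π : Permutation n n) → Injective _≡_ _≡_ (π ⟨$⟩ʳ_)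
⟨$⟩ʳ-injective π = Injection.injective (↔⇒↣ π)

transpose-here : ∀ {n} (i j : Fin n) → transpose i j ⟨$⟩ʳ i ≡ j
transpose-here i j rewrite dec-true (i ≟ᶠ i) refl = refl

transpose-elsewhere : ∀ {n} {i j k : Fin n} → k ≢ i → k ≢ j → transpose i j ⟨$⟩ʳ k ≡ k
transpose-elsewhere {i = i} {j} {k} k≢i k≢j
  rewrite dec-false (k ≟ᶠ i) k≢i | dec-false (k ≟ᶠ j) k≢j = refl

-- Built one transposition at a time; each new transposition fixes the
-- values already placed because f and g are injective.
extendToPermutation : ∀ {m n} (f g : Fin m → Fin n) → Injective _≡_ _≡_ f → Injective _≡_ _≡_ g →
                      Σ[ π ∈ Permutation n n ] (∀ i → π ⟨$⟩ʳ f i ≡ g i)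
extendToPermutation {zero}  f g _ _ = id , λ ()
extendToPermutation {suc m} f g f-inj g-inj = π ∘ₚ τ , maps
  where
  rest = extendToPermutation (f ∘ suc) (g ∘ suc) (sucᶠ-injective ∘ f-inj) (sucᶠ-injective ∘ g-inj)
  π = proj₁ rest
  τ = transpose (π ⟨$⟩ʳ f zero) (g zero)
  maps : ∀ i → τ ⟨$⟩ʳ (π ⟨$⟩ʳ f i) ≡ g i
  maps zero    = transpose-here (π ⟨$⟩ʳ f zero) (g zero)
  maps (suc i) rewrite proj₂ rest i = transpose-elsewhere
    (λ e → zero≢sucᶠ (sym (f-inj (⟨$⟩ʳ-injective π (trans (proj₂ rest i) e)))))
    (λ e → zero≢sucᶠ (sym (g-inj e)))

module _ {n} (π : Permutation n n) where

  conjugate : (Fin n → Fin n) → Fin n → Fin n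
  conjugate f u = π ⟨$⟩ˡ f (π ⟨$⟩ʳ u)

  conjugate-involutive : ∀ {f} → Involutive _≡_ f → Involutive _≡_ (conjugate f)
  conjugate-involutive {f} f-inv u = begin
    π ⟨$⟩ˡ f (π ⟨$⟩ʳ (π ⟨$⟩ˡ f (π ⟨$⟩ʳ u))) ≡⟨ cong (λ w → π ⟨$⟩ˡ f w) (inverseʳ π) ⟩
    π ⟨$⟩ˡ f (f (π ⟨$⟩ʳ u))                  ≡⟨ cong (π ⟨$⟩ˡ_) (f-inv (π ⟨$⟩ʳ u)) ⟩
    π ⟨$⟩ˡ (π ⟨$⟩ʳ u)                        ≡⟨ inverseˡ π ⟩
    u                                        ∎
    where open ≡-Reasoning

  conjugate-fixed : ∀ {f u} → f (π ⟨$⟩ʳ u) ≡ π ⟨$⟩ʳ u → conjugate f u ≡ u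
  conjugate-fixed e = trans (cong (π ⟨$⟩ˡ_) e) (inverseˡ π)

  ⟨$⟩ʳ-conjugate : ∀ {f u v} → v ≡ conjugate f u → π ⟨$⟩ʳ v ≡ f (π ⟨$⟩ʳ u)
  ⟨$⟩ʳ-conjugate e = trans (cong (π ⟨$⟩ʳ_) e) (inverseʳ π)

module _ {n} (σ : Bool → Fin n → Fin n) where

  Adjacent : Fin n → Fin n → Set
  Adjacent u v = u ≢ v × (v ≡ σ false u ⊎ v ≡ σ true u)

  adjacent? : ∀ u v → Dec (Adjacent u v)
  adjacent? u v = ¬? (u ≟ᶠ v) ×-dec (v ≟ᶠ σ false u ⊎-dec v ≟ᶠ σ true u)

  adjacent-via-fixed : ∀ {u v} b → σ b u ≡ u → Adjacent u v → v ≡ σ (not b) u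
  adjacent-via-fixed false fixed (u≢v , inj₁ e) = ⊥-elim (u≢v (sym (trans e fixed)))
  adjacent-via-fixed false fixed (_   , inj₂ e) = e
  adjacent-via-fixed true  fixed (_   , inj₁ e) = e
  adjacent-via-fixed true  fixed (u≢v , inj₂ e) = ⊥-elim (u≢v (sym (trans e fixed)))

  adjacent-to-moved : ∀ {u} b → σ b u ≢ u → Adjacent u (σ b u)
  adjacent-to-moved false moved = moved ∘ sym , inj₁ refl
  adjacent-to-moved true  moved = moved ∘ sym , inj₂ refl

  module _ (σ-involutive : ∀ b → Involutive _≡_ (σ b)) where

    adjacent-sym : ∀ {u v} → Adjacent u v → Adjacent v u
    adjacent-sym {u} (u≢v , inj₁ refl) = u≢v ∘ sym , inj₁ (sym (σ-involutive false u))
    adjacent-sym {u} (u≢v , inj₂ refl) = u≢v ∘ sym , inj₂ (sym (σ-involutive true u))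

    involutionGraph : SimpleGraph n
    involutionGraph = record
      { adj    = λ u v → does (adjacent? u v)
      ; sym    = λ u v → does-⇔ (mk⇔ adjacent-sym adjacent-sym) (adjacent? u v) (adjacent? v u)
      ; irrefl = λ v → dec-false (adjacent? v v) λ (v≢v , _) → v≢v refl
      }

    degree-one-fixed : ∀ u b → σ b u ≡ u → σ (not b) u ≢ u → degree involutionGraph u ≡ 1
    degree-one-fixed u b fixed moved =
      trans (sum-𝟙-allFin (does ∘ adjacent? u)) (count-exactly-one (adjacent? u) λ v →
        mk⇔ (adjacent-via-fixed b fixed) λ { refl → adjacent-to-moved (not b) moved })

    degree-none-fixed : ∀ u → (∀ b → σ b u ≢ u) → σ false u ≢ σ true u → degree involutionGraph u ≡ 2
    degree-none-fixed u moved apart =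
      trans (sum-𝟙-allFin (does ∘ adjacent? u)) (count-exactly-two (adjacent? u) apart λ v →
        mk⇔ proj₂ λ { (inj₁ refl) → adjacent-to-moved false (moved false)
                    ; (inj₂ refl) → adjacent-to-moved true (moved true) })

-- For x, y, s < n this is exactly the congruence x + y ≡ s modulo n.
_⊕_≈_mod_ : ℕ → ℕ → ℕ → ℕ → Set
x ⊕ y ≈ s mod n = x + y ≡ s ⊎ x + y ≡ s + n

sum-mod-comm : ∀ {n s} x y → x ⊕ y ≈ s mod n → y ⊕ x ≈ s mod n
sum-mod-comm {n} {s} x y = subst (λ m → m ≡ s ⊎ m ≡ s + n) (+-comm x y)

sum-mod-unique : ∀ {n s t} x y → s < n → t < n → x ⊕ y ≈ s mod n → x ⊕ y ≈ t mod n → s ≡ t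
sum-mod-unique _ _ _ _ (inj₁ e) (inj₁ e′) = trans (sym e) e′
sum-mod-unique {n} {t = t} _ _ s<n _ (inj₁ e) (inj₂ e′) =
  ⊥-elim (<⇒≱ s<n (subst (n ≤_) (trans (sym e′) e) (m≤n+m n t)))
sum-mod-unique {n} {s} _ _ _ t<n (inj₂ e) (inj₁ e′) =
  ⊥-elim (<⇒≱ t<n (subst (n ≤_) (trans (sym e) e′) (m≤n+m n s)))
sum-mod-unique {n} {s} {t} _ _ _ _ (inj₂ e) (inj₂ e′) = +-cancelʳ-≡ n s t (trans (sym e) e′)

partner : ℕ → ℕ → ℕ → ℕ
partner n s x with x ≤? s
... | yes _ = s ∸ x
... | no  _ = s + n ∸ x

partner-sum : ∀ {n s x} → x < n → x ⊕ partner n s x ≈ s mod n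
partner-sum {n} {s} {x} x<n with x ≤? s
... | yes x≤s = inj₁ (m+[n∸m]≡n x≤s)
... | no  _   = inj₂ (m+[n∸m]≡n (≤-trans (<⇒≤ x<n) (m≤n+m n s)))

partner<n : ∀ {n s x} → s < n → x < n → partner n s x < n
partner<n {n} {s} {x} s<n x<n with x ≤? s
... | yes _   = ≤-<-trans (m∸n≤m s x) s<n
... | no  x≰s = +-cancelˡ-< x (s + n ∸ x) n (begin-strict
  x + (s + n ∸ x) ≡⟨ m+[n∸m]≡n (≤-trans (<⇒≤ x<n) (m≤n+m n s)) ⟩
  s + n           <⟨ +-monoˡ-< n (≰⇒> x≰s) ⟩
  x + n           ∎)
  where open ≤-Reasoning

partner-unique : ∀ {n s x y} → x < n → y < n → x ⊕ y ≈ s mod n → y ≡ partner n s x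
partner-unique {n} {s} {x} {y} x<n y<n sum with x ≤? s | sum
... | yes _   | inj₁ e = trans (sym (m+n∸m≡n x y)) (cong (_∸ x) e)
... | yes x≤s | inj₂ e = ⊥-elim (<-irrefl e (+-mono-≤-< x≤s y<n))
... | no  x≰s | inj₁ e = ⊥-elim (x≰s (subst (x ≤_) e (m≤m+n x y)))
... | no  _   | inj₂ e = trans (sym (m+n∸m≡n x y)) (cong (_∸ x) e)

module _ {n s} (s<n : s < n) where

  reflect : Fin n → Fin n
  reflect x = fromℕ< (partner<n s<n (toℕ<n x))

  reflect-sum : ∀ x → toℕ x ⊕ toℕ (reflect x) ≈ s mod n
  reflect-sum x = subst (λ y → toℕ x ⊕ y ≈ s mod n) (sym (toℕ-fromℕ< _)) (partner-sum (toℕ<n x))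

  reflect-unique : ∀ {x y} → toℕ x ⊕ toℕ y ≈ s mod n → y ≡ reflect x
  reflect-unique {x} {y} sum =
    toℕ-injective (trans (partner-unique (toℕ<n x) (toℕ<n y) sum) (sym (toℕ-fromℕ< _)))

  reflect-involutive : Involutive _≡_ reflect
  reflect-involutive x = sym (reflect-unique (sum-mod-comm (toℕ x) _ (reflect-sum x)))

  reflect-fixed : ∀ {x} → toℕ x ⊕ toℕ x ≈ s mod n → reflect x ≡ x
  reflect-fixed sum = sym (reflect-unique sum)

𝟙≤1 : ∀ b → 𝟙 b ≤ 1
𝟙≤1 false = z≤n
𝟙≤1 true  = ≤-refl

𝟙≢2+ : ∀ b {m} → 𝟙 b ≢ 2 + m
𝟙≢2+ false ()
𝟙≢2+ true  ()

double+bit-suc : ∀ x b → suc x + suc x + 𝟙 b ≡ 2 + (x + x + 𝟙 b)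
double+bit-suc x b = cong (λ m → suc m + 𝟙 b) (+-suc x x)

double+bit-injective : ∀ x y {b c} → x + x + 𝟙 b ≡ y + y + 𝟙 c → x ≡ y × b ≡ c
double+bit-injective zero    zero    {false} {false} _ = refl , refl
double+bit-injective zero    zero    {true}  {true}  _ = refl , refl
double+bit-injective zero    (suc y) {b}     {c}     e = ⊥-elim (𝟙≢2+ b (trans e (double+bit-suc y c)))
double+bit-injective (suc x) zero    {b}     {c}     e = ⊥-elim (𝟙≢2+ c (trans (sym e) (double+bit-suc x b)))
double+bit-injective (suc x) (suc y) {b}     {c}     e
  with x≡y , b≡c ← double+bit-injective x y (suc-injective (suc-injective
                     (trans (sym (double+bit-suc x b)) (trans e (double+bit-suc y c)))))
  = cong suc x≡y , b≡c

⌈n/2⌉-double : ∀ n → ∃[ r ] ⌈ n /2⌉ + ⌈ n /2⌉ ≡ 𝟙 r + n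
⌈n/2⌉-double zero       = false , refl
⌈n/2⌉-double (suc zero) = true , refl
⌈n/2⌉-double (suc (suc n)) with r , e ← ⌈n/2⌉-double n = r , (begin
  suc h + suc h         ≡⟨ cong suc (+-suc h h) ⟩
  suc (suc (h + h))     ≡⟨ cong (2 +_) e ⟩
  suc (suc (𝟙 r + n))   ≡⟨ cong suc (+-suc (𝟙 r) n) ⟨
  suc (𝟙 r + suc n)     ≡⟨ +-suc (𝟙 r) (suc n) ⟨
  𝟙 r + suc (suc n)     ∎)
  where
  open ≡-Reasoning
  h = ⌈ n /2⌉

module Construction {k n} (D : Fin k → DegSeq n)
                    (path : ∀ i → IsPathDegSeq (D i)) (no-common : NoCommonLeaves D) where

  leaf : Fin k ⊎ Fin k → Fin n
  leaf (inj₁ i) = proj₁ (path i)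
  leaf (inj₂ i) = proj₁ (proj₂ (path i))

  index : Fin k ⊎ Fin k → Fin k
  index = [ (λ i → i) , (λ i → i) ]′

  leaves-distinct : ∀ i → leaf (inj₁ i) ≢ leaf (inj₂ i)
  leaves-distinct i = proj₁ (proj₂ (proj₂ (path i)))

  leaf-degree : ∀ x → D (index x) (leaf x) ≡ 1
  leaf-degree (inj₁ i) = proj₁ (proj₂ (proj₂ (proj₂ (path i))))
  leaf-degree (inj₂ i) = proj₁ (proj₂ (proj₂ (proj₂ (proj₂ (path i)))))

  inner-degree : ∀ i v → v ≢ leaf (inj₁ i) → v ≢ leaf (inj₂ i) → D i v ≡ 2
  inner-degree i = proj₂ (proj₂ (proj₂ (proj₂ (proj₂ (path i)))))

  same-index : ∀ {x y} → leaf x ≡ leaf y → index x ≡ index y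
  same-index {x} {y} e with index x ≟ᶠ index y
  ... | yes same   = same
  ... | no  differ = ⊥-elim (<-irrefl (sym (subst (λ v → D (index y) v ≡ 1) (sym e) (leaf-degree y)))
                                      (no-common (leaf x) (index x) (index y) differ (leaf-degree x)))

  leaf-injective : Injective _≡_ _≡_ leaf
  leaf-injective {inj₁ i} {inj₁ j} e = cong inj₁ (same-index {inj₁ i} {inj₁ j} e)
  leaf-injective {inj₂ i} {inj₂ j} e = cong inj₂ (same-index {inj₂ i} {inj₂ j} e)
  leaf-injective {inj₁ i} {inj₂ j} e with refl ← same-index {inj₁ i} {inj₂ j} e =
    ⊥-elim (leaves-distinct i e)
  leaf-injective {inj₂ i} {inj₁ j} e with refl ← same-index {inj₂ i} {inj₁ j} e =
    ⊥-elim (leaves-distinct i (sym e))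

  splitAt-injective : Injective _≡_ _≡_ (splitAt k {k})
  splitAt-injective = Injection.injective (↔⇒↣ (+↔⊎ {k} {k}))

  k+k≤n : k + k ≤ n
  k+k≤n = injective⇒≤ (splitAt-injective ∘ leaf-injective)

  h : ℕ
  h = ⌈ n /2⌉

  r : Bool
  r = proj₁ (⌈n/2⌉-double n)

  h+h : h + h ≡ 𝟙 r + n
  h+h = proj₂ (⌈n/2⌉-double n)

  i<⌊n/2⌋ : ∀ (i : Fin k) → toℕ i < ⌊ n /2⌋
  i<⌊n/2⌋ i = <-≤-trans (toℕ<n i) (subst (_≤ ⌊ n /2⌋) (sym (n≡⌊n+n/2⌋ k)) (⌊n/2⌋-mono k+k≤n))

  i<h : ∀ (i : Fin k) → toℕ i < h
  i<h i = <-≤-trans (i<⌊n/2⌋ i) (⌊n/2⌋≤⌈n/2⌉ n)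

  slotℕ : Fin k ⊎ Fin k → ℕ
  slotℕ (inj₁ i) = toℕ i
  slotℕ (inj₂ i) = toℕ i + h

  slotℕ<n : ∀ x → slotℕ x < n
  slotℕ<n (inj₁ i) = <-≤-trans (i<⌊n/2⌋ i) (⌊n/2⌋≤n n)
  slotℕ<n (inj₂ i) = subst (toℕ i + h <_) (⌊n/2⌋+⌈n/2⌉≡n n) (+-monoˡ-< h (i<⌊n/2⌋ i))

  slotℕ-injective : ∀ {x y} → slotℕ x ≡ slotℕ y → x ≡ y
  slotℕ-injective {inj₁ i} {inj₁ j} e = cong inj₁ (toℕ-injective e)
  slotℕ-injective {inj₁ i} {inj₂ j} e = ⊥-elim (<⇒≱ (i<h i) (subst (h ≤_) (sym e) (m≤n+m h (toℕ j))))
  slotℕ-injective {inj₂ i} {inj₁ j} e = ⊥-elim (<⇒≱ (i<h j) (subst (h ≤_) e (m≤n+m h (toℕ i))))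
  slotℕ-injective {inj₂ i} {inj₂ j} e = cong inj₂ (toℕ-injective (+-cancelʳ-≡ h _ _ e))

  slot : Fin k ⊎ Fin k → Fin n
  slot x = fromℕ< (slotℕ<n x)

  slot-injective : Injective _≡_ _≡_ slot
  slot-injective {x} {y} e =
    slotℕ-injective (trans (sym (toℕ-fromℕ< (slotℕ<n x))) (trans (cong toℕ e) (toℕ-fromℕ< (slotℕ<n y))))

  relabelling : Σ[ π ∈ Permutation n n ] (∀ z → π ⟨$⟩ʳ leaf (splitAt k z) ≡ slot (splitAt k z))
  relabelling = extendToPermutation (leaf ∘ splitAt k) (slot ∘ splitAt k)
                  (splitAt-injective ∘ leaf-injective) (splitAt-injective ∘ slot-injective)

  π : Permutation n n
  π = proj₁ relabelling

  π-leaf : ∀ x → toℕ (π ⟨$⟩ʳ leaf x) ≡ slotℕ x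
  π-leaf x = trans (cong toℕ (subst (λ y → π ⟨$⟩ʳ leaf y ≡ slot y) (splitAt-join k k x)
                                    (proj₂ relabelling (join k k x))))
                   (toℕ-fromℕ< (slotℕ<n x))

  π-leaf-unique : ∀ {u} x → toℕ (π ⟨$⟩ʳ u) ≡ slotℕ x → u ≡ leaf x
  π-leaf-unique x e = ⟨$⟩ʳ-injective π (toℕ-injective (trans e (sym (π-leaf x))))

  class : Fin k → Bool → ℕ
  class i b = toℕ i + toℕ i + 𝟙 b

  class<n : ∀ i b → class i b < n
  class<n i b = begin-strict
    j + j + 𝟙 b   ≤⟨ +-monoʳ-≤ (j + j) (𝟙≤1 b) ⟩
    j + j + 1     ≡⟨ +-comm (j + j) 1 ⟩
    suc (j + j)   ≡⟨ +-suc j j ⟨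
    j + suc j     <⟨ n<1+n (j + suc j) ⟩
    suc j + suc j ≤⟨ +-mono-≤ (toℕ<n i) (toℕ<n i) ⟩
    k + k         ≤⟨ k+k≤n ⟩
    n             ∎
    where
    open ≤-Reasoning
    j = toℕ i

  endBit : Fin k ⊎ Fin k → Bool
  endBit (inj₁ _) = false
  endBit (inj₂ _) = r

  second-end-double : ∀ j → (j + h) + (j + h) ≡ j + j + 𝟙 r + n
  second-end-double j = begin
    (j + h) + (j + h)   ≡⟨ interchange j h j h ⟩
    (j + j) + (h + h)   ≡⟨ cong (j + j +_) h+h ⟩
    (j + j) + (𝟙 r + n) ≡⟨ +-assoc (j + j) (𝟙 r) n ⟨
    j + j + 𝟙 r + n     ∎
    where open ≡-Reasoning

  end-self-sum : ∀ x → slotℕ x ⊕ slotℕ x ≈ class (index x) (endBit x) mod n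
  end-self-sum (inj₁ i) = inj₁ (sym (+-identityʳ _))
  end-self-sum (inj₂ i) = inj₂ (second-end-double (toℕ i))

  -- both m + m and (j + h) + (j + h) exceed 2j by n plus one bit
  wrapped-self-sum : ∀ {m} j b → m + m ≡ j + j + 𝟙 b + n → m + m + 𝟙 r ≡ (j + h) + (j + h) + 𝟙 b
  wrapped-self-sum {m} j b e = begin
    m + m + 𝟙 r             ≡⟨ cong (_+ 𝟙 r) e ⟩
    j + j + 𝟙 b + n + 𝟙 r   ≡⟨ swap-bits (j + j) (𝟙 b) n (𝟙 r) ⟩
    j + j + 𝟙 r + n + 𝟙 b   ≡⟨ cong (_+ 𝟙 b) (second-end-double j) ⟨
    (j + h) + (j + h) + 𝟙 b ∎
    where
    open ≡-Reasoning
    swap-bits : ∀ a b c d → a + b + c + d ≡ a + d + c + b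
    swap-bits = solve-∀

  self-sum-end : ∀ {m} i b → m ⊕ m ≈ class i b mod n →
                 (m ≡ slotℕ (inj₁ i) × b ≡ false) ⊎ (m ≡ slotℕ (inj₂ i) × b ≡ r)
  self-sum-end {m} i b (inj₁ e)
    with m≡i , false≡b ← double+bit-injective m (toℕ i) (trans (+-identityʳ (m + m)) e)
    = inj₁ (m≡i , sym false≡b)
  self-sum-end {m} i b (inj₂ e)
    with m≡i+h , r≡b ← double+bit-injective m (toℕ i + h) (wrapped-self-sum {m} (toℕ i) b e)
    = inj₂ (m≡i+h , sym r≡b)

  σ : Fin k → Bool → Fin n → Fin n
  σ i b = conjugate π (reflect (class<n i b))

  σ-involutive : ∀ i b → Involutive _≡_ (σ i b)
  σ-involutive i b = conjugate-involutive π {reflect (class<n i b)} (reflect-involutive (class<n i b))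

  G : Fin k → SimpleGraph n
  G i = involutionGraph (σ i) (σ-involutive i)

  σ-sum : ∀ i b u {v} → v ≡ σ i b u → toℕ (π ⟨$⟩ʳ u) ⊕ toℕ (π ⟨$⟩ʳ v) ≈ class i b mod n
  σ-sum i b u e = subst (λ w → toℕ (π ⟨$⟩ʳ u) ⊕ toℕ w ≈ class i b mod n)
                        (sym (⟨$⟩ʳ-conjugate π {reflect (class<n i b)} e))
                        (reflect-sum (class<n i b) (π ⟨$⟩ʳ u))

  same-class : ∀ i j b c u {v} → v ≡ σ i b u → v ≡ σ j c u → toℕ i ≡ toℕ j × b ≡ c
  same-class i j b c u {v} e e′ = double+bit-injective (toℕ i) (toℕ j)
    (sum-mod-unique (toℕ (π ⟨$⟩ʳ u)) (toℕ (π ⟨$⟩ʳ v)) (class<n i b) (class<n j c)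
                    (σ-sum i b u e) (σ-sum j c u e′))

  leaf-fixed : ∀ x → σ (index x) (endBit x) (leaf x) ≡ leaf x
  leaf-fixed x = conjugate-fixed π {reflect s<n} (reflect-fixed s<n
    (subst (λ m → m ⊕ m ≈ class (index x) (endBit x) mod n) (sym (π-leaf x)) (end-self-sum x)))
    where s<n = class<n (index x) (endBit x)

  leaf-fixed⁻¹ : ∀ x {b} → σ (index x) b (leaf x) ≡ leaf x → b ≡ endBit x
  leaf-fixed⁻¹ (inj₁ i) {b} fixed with self-sum-end i b (σ-sum i b (leaf (inj₁ i)) (sym fixed))
  ... | inj₁ (_ , b≡false) = b≡false
  ... | inj₂ (e , _)       with () ← leaf-injective {inj₁ i} {inj₂ i} (π-leaf-unique (inj₂ i) e)
  leaf-fixed⁻¹ (inj₂ i) {b} fixed with self-sum-end i b (σ-sum i b (leaf (inj₂ i)) (sym fixed))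
  ... | inj₁ (e , _)       with () ← leaf-injective {inj₂ i} {inj₁ i} (π-leaf-unique (inj₁ i) e)
  ... | inj₂ (_ , b≡r)     = b≡r

  fixed-is-leaf : ∀ i b u → σ i b u ≡ u → u ≡ leaf (inj₁ i) ⊎ u ≡ leaf (inj₂ i)
  fixed-is-leaf i b u fixed with self-sum-end i b (σ-sum i b u (sym fixed))
  ... | inj₁ (e , _) = inj₁ (π-leaf-unique (inj₁ i) e)
  ... | inj₂ (e , _) = inj₂ (π-leaf-unique (inj₂ i) e)

  degree-leaf : ∀ x → degree (G (index x)) (leaf x) ≡ 1
  degree-leaf x = degree-one-fixed (σ (index x)) (σ-involutive (index x)) (leaf x) (endBit x)
    (leaf-fixed x) (λ fixed → not-¬ refl (sym (leaf-fixed⁻¹ x fixed)))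

  degree-inner : ∀ i u → u ≢ leaf (inj₁ i) → u ≢ leaf (inj₂ i) → degree (G i) u ≡ 2
  degree-inner i u ≢leaf₁ ≢leaf₂ = degree-none-fixed (σ i) (σ-involutive i) u
    (λ b fixed → [ ≢leaf₁ , ≢leaf₂ ]′ (fixed-is-leaf i b u fixed))
    (λ e → case proj₂ (same-class i i false true u refl e) of λ ())

  realizes : ∀ i → Realizes (G i) (D i)
  realizes i u with u ≟ᶠ leaf (inj₁ i) | u ≟ᶠ leaf (inj₂ i)
  ... | yes refl  | _         = trans (degree-leaf (inj₁ i)) (sym (leaf-degree (inj₁ i)))
  ... | no _      | yes refl  = trans (degree-leaf (inj₂ i)) (sym (leaf-degree (inj₂ i)))
  ... | no ≢leaf₁ | no ≢leaf₂ =
    trans (degree-inner i u ≢leaf₁ ≢leaf₂) (sym (inner-degree i u ≢leaf₁ ≢leaf₂))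

  edge-disjoint : EdgeDisjoint G
  edge-disjoint i j i≢j u v adj-i = dec-false (adjacent? (σ j) u v) λ adj-j →
    let b , e = edge-class i (does-true⇒ (adjacent? (σ i) u v) adj-i)
        c , e′ = edge-class j adj-j
    in i≢j (toℕ-injective (proj₁ (same-class i j b c u e e′)))
    where
    edge-class : ∀ i {u v} → Adjacent (σ i) u v → ∃[ b ] v ≡ σ i b u
    edge-class _ (_ , inj₁ e) = false , e
    edge-class _ (_ , inj₂ e) = true , e

lemma4 : (k n : ℕ) (D : Fin k → DegSeq n) →
    (∀ i → IsPathDegSeq (D i)) → NoCommonLeaves D →
    ∃[ G ] (EdgeDisjoint {k} {n} G × (∀ i → Realizes (G i) (D i)))
lemma4 k n D path no-common = G , edge-disjoint , realizes
  where open Construction D path no-common
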